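{- Let $C>100$, let $G$ be an $n$-vertex graph, let $\mathcal{F}$ be a linear forest in $G$, $v$ an endpoint of $\mathcal{F}$, and $U$ an $(\mathcal{F},C)$-expander containing $v$. Then $|E^{k}_U(v,\mathcal{F})|\ge |U|/10^5$ for $k=2\log_C n$.
   Context: A linear forest is a vertex-disjoint union of paths (single vertices allowed). For $X\subseteq V(G)$, $N_G(X)$ is the set of vertices outside $X$ adjacent to some vertex of $X$. For a vertex set $U$, $\mathrm{int}_{\mathcal{F}}(U)=\{u\in U: \text{all neighbours of } u \text{ in } \mathcal{F} \text{ lie in } U\}$. For $U,V\subseteq V(G)$ with $|U|\ge 10^5C$, $U$ $C$-expands into $V$ if every $X\subseteq U$ with $|X|\le |U|/5000C$ has $|N_G(X)\cap V|\ge C|X|$; $U\subseteq V(\mathcal{F})$ is an $(\mathcal{F},C)$-expander if $U$ $C$-expands into $\mathrm{int}_{\mathcal{F}}(U)$. 1-rotation: let $P_1,P_2$ be (possibly equal) paths of $\mathcal{F}$, $x$ an endpoint of $P_1$, $z$ a neighbour in $G$ of $x$ on $P_2$. If $P_2$ has an edge, let $y$ be a neighbour of $z$ on $P_2$ (if $P_1=P_2$, the one closer to $x$, possibly $y=x$); otherwise $y=z$. Removing $yz$ (if $y\neq z$) and adding $xz$ gives a 1-rotation with old endpoint $x$, new endpoint $y$, pivot $z$. A $k$-rotation is a sequence of $k$ consecutive 1-rotations where each old endpoint is the previous new endpoint and each pivot is at distance at least $3$ in $\mathcal{F}$ from the first old endpoint and from all earlier pivots; its old/new endpoints are the first old endpoint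 and last new endpoint. A $(U,i)$-rotation is an $i$-rotation with all pivots in $\mathrm{int}_{\mathcal{F}}(U)$. $E^k_U(v,\mathcal{F})$ is the set of new endpoints of $(U,i)$-rotations of $\mathcal{F}$ starting from $v$ with $i\le k$ (the $0$-rotation being $\mathcal{F}$ itself with new endpoint $v$).
   Formalization: The constant C is a rational number greater than 100. -}

module Defs where

open import Data.Nat as ℕ using (ℕ; zero; suc)
open import Data.Integer using (+_)
open import Data.Rational as ℚ using (ℚ; 1ℚ)
open import Data.Bool using (Bool; true; false; if_then_else_; _∧_; _∨_)
open import Data.Fin using (Fin; _≟_)
open import Data.Fin.Subset as Sub using (Subset; _∈_; _∉_; ∣_∣)
open import Data.List using (List; []; _∷_; concat)
import Data.List.Membership.Propositional as LM
open import Data.List.Relation.Unary.All using (All)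
open import Data.List.Relation.Unary.AllPairs using (AllPairs)
open import Data.List.Relation.Unary.Unique.Propositional using (Unique)
open import Data.Product using (Σ; ∃; ∃-syntax; _×_; _,_)
open import Data.Sum using (_⊎_)
open import Relation.Binary.PropositionalEquality using (_≡_; _≢_)
open import Relation.Binary.Construct.Closure.ReflexiveTransitive using (Star)
open import Relation.Nullary using (¬_)
open import Relation.Nullary.Decidable using (⌊_⌋)
open import Function.Bundles using (_⇔_)

ℕ→ℚ : ℕ → ℚ
ℕ→ℚ n = + n ℚ./ 1

_^ℚ_ : ℚ → ℕ → ℚ
q ^ℚ zero  = 1ℚ
q ^ℚ suc i = q ℚ.* (q ^ℚ i)

record Graph (n : ℕ) : Set where
  field
    adj    : Fin n → Fin n → Bool
    sym    : ∀ a b → adj a b ≡ adj b a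
    irrefl : ∀ a → adj a a ≡ false
open Graph public

Edges : ℕ → Set
Edges n = Fin n → Fin n → Bool

data Consec {n : ℕ} (a b : Fin n) : List (Fin n) → Set where
  here  : ∀ {l} → Consec a b (a ∷ b ∷ l)
  there : ∀ {c l} → Consec a b l → Consec a b (c ∷ l)

data NonEmpty {n : ℕ} : List (Fin n) → Set where
  nonEmpty : ∀ {a l} → NonEmpty (a ∷ l)

-- A path is a nonempty list of distinct
-- vertices, its edges being the pairs of consecutive vertices.
record IsLinearForest {n : ℕ} (G : Graph n) (vs : Subset n) (E : Edges n) : Set where
  field
    paths      : List (List (Fin n))
    nonempty   : All NonEmpty paths
    disjoint   : Unique (concat paths)
    vertices   : ∀ a → (a ∈ vs) ⇔ (a LM.∈ concat paths)
    edges      : ∀ a b → (E a b ≡ true) ⇔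
                   (∃[ p ] (p LM.∈ paths × (Consec a b p ⊎ Consec b a p)))
    subgraph   : ∀ a b → E a b ≡ true → adj G a b ≡ true

IsEndpoint : ∀ {n} → Subset n → Edges n → Fin n → Set
IsEndpoint vs E x = x ∈ vs × (∀ a b → E x a ≡ true → E x b ≡ true → a ≡ b)

Reach : ∀ {n} → Edges n → Fin n → Fin n → Set
Reach E = Star (λ u w → E u w ≡ true)

ReachAvoid : ∀ {n} → Edges n → Fin n → Fin n → Fin n → Set
ReachAvoid E z = Star (λ u w → E u w ≡ true × u ≢ z × w ≢ z)

Near : ∀ {n} → Edges n → Fin n → Fin n → Set
Near E a b = a ≡ b ⊎ E a b ≡ true ⊎ (∃[ c ] (E a c ≡ true × E c b ≡ true))

Far : ∀ {n} → Edges n → Fin n → Fin n → Set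
Far E a b = ¬ Near E a b

samePair : ∀ {n} → Fin n → Fin n → Fin n → Fin n → Bool
samePair a b c d = (⌊ a ≟ c ⌋ ∧ ⌊ b ≟ d ⌋) ∨ (⌊ a ≟ d ⌋ ∧ ⌊ b ≟ c ⌋)

rotate : ∀ {n} → Edges n → Fin n → Fin n → Fin n → Edges n
rotate E x y z a b =
  if samePair a b x z then true
  else if samePair a b y z then false
  else E a b

-- A 1-rotation of (vs , E) with old endpoint x, new endpoint y, pivot z
-- (the resulting forest is  rotate E x y z ).
record OneRot {n : ℕ} (G : Graph n) (vs : Subset n) (E : Edges n)
              (x y z : Fin n) : Set where
  field
    old-endpoint : IsEndpoint vs E x
    pivot-in     : z ∈ vs
    pivot-adj    : adj G x z ≡ true
    choice       :
      -- the path of z has an edge: y is a forest-neighbour of z, and if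
      -- z lies on the path of x then y is the one closer to x
      (E z y ≡ true × (Reach E x z → ReachAvoid E z x y))
      ⊎
      ((∀ w → E z w ≡ false) × y ≡ z)

data RotSeq {n : ℕ} (G : Graph n) (vs : Subset n) :
            Edges n → Fin n → ℕ → Edges n → Fin n → List (Fin n) → Set where
  done : ∀ {E x} → RotSeq G vs E x zero E x []
  step : ∀ {E x y z i E' w ps} →
         OneRot G vs E x y z →
         RotSeq G vs (rotate E x y z) y i E' w ps →
         RotSeq G vs E x (suc i) E' w (z ∷ ps)

Int : ∀ {n} → Edges n → Subset n → Fin n → Set
Int E U u = u ∈ U × (∀ w → E u w ≡ true → w ∈ U)

-- w ∈ E^k_U(v,F), with "i ≤ k" supplied as a predicate on i:
-- w is the new endpoint of a (U,i)-rotation of F from v with  Ok i.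
InE : ∀ {n} → Graph n → Subset n → Edges n → Subset n →
      (ℕ → Set) → Fin n → Fin n → Set
InE G vs E U Ok v w =
  ∃[ i ] ∃[ E' ] ∃[ ps ]
    ( Ok i
    × RotSeq G vs E v i E' w ps
    × All (Far E v) ps
    × AllPairs (Far E) ps
    × All (Int E U) ps )

-- U C-expands into V (V given as a predicate):
-- |U| ≥ 10^5 C, and every X ⊆ U with |X| ≤ |U|/5000C has
-- |N_G(X) ∩ V| ≥ C|X| (witnessed by a set S ⊆ N_G(X) ∩ V of that size).
Expands : ∀ {n} → Graph n → ℚ → Subset n → (Fin n → Set) → Set
Expands {n} G C U V =
  (ℕ→ℚ 100000 ℚ.* C ℚ.≤ ℕ→ℚ ∣ U ∣)
  × (∀ (X : Subset n) → X Sub.⊆ U →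
       ℕ→ℚ 5000 ℚ.* C ℚ.* ℕ→ℚ ∣ X ∣ ℚ.≤ ℕ→ℚ ∣ U ∣ →
       ∃[ S ] ((∀ w → w ∈ S →
                  w ∉ X × (∃[ x ] (x ∈ X × adj G x w ≡ true)) × V w)
               × C ℚ.* ℕ→ℚ ∣ X ∣ ℚ.≤ ℕ→ℚ ∣ S ∣))

IsExpander : ∀ {n} → Graph n → Subset n → Edges n → ℚ → Subset n → Set
IsExpander G vs E C U = U Sub.⊆ vs × Expands G C U (Int E U)

{-# OPTIONS --safe #-}
-- Round C down to a natural number c ≥ 100 and let m = ⌊|U| / 5000(c + 1)⌋.  Keep a set T of
-- distinct endpoints, starting from {v}, each reached from v by an i-rotation whose pivots lie in
-- a set B of forbidden vertices with |B| ≤ 2|T|.  Expansion gives c|T| interior vertices of U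
-- adjacent to T.  Greedily keeping those at distance ≥ 3 from B and from each other leaves z of
-- them with c|T| ≤ 7(z + |B|), since a ball of radius 2 in a graph of maximum degree two has at
-- most 7 vertices.  A rotation at each kept pivot gives a new endpoint within distance 1 of it, so
-- the z new endpoints are distinct; thus |T| grows tenfold per round while (c + 1)^i ≤ |T|².  The
-- rotated forests agree with F away from B, so a new pivot still has its neighbours from F.  Once
-- z ≥ m, rotating at m pivots and expanding once more gives |U| / 10⁵ endpoints after i + 2
-- rounds, where (c + 1)^(i + 2) ≤ n², i.e. i + 2 ≤ 2 log_C n.

module Submission where

module GrowthArithmetic where

  open import Data.Nat using (ℕ; suc; _+_; _*_; _^_; _≤_; _<_; NonZero)
  open import Data.Nat.Properties
  open import Data.Nat.Tactic.RingSolver using (solve)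
  open import Data.List using ([]; _∷_)
  open import Relation.Binary.PropositionalEquality
  open import Data.Nat.DivMod using (_/_; _%_; m≡m%n+[m/n]*n; m%n<n)

  m<[1+m/n]*n : ∀ m n .{{_ : NonZero n}} → m < suc (m / n) * n
  m<[1+m/n]*n m n = begin-strict
    m                   ≡⟨ m≡m%n+[m/n]*n m n ⟩
    m % n + m / n * n   <⟨ +-monoˡ-< (m / n * n) (m%n<n m n) ⟩
    n + m / n * n       ∎
    where open ≤-Reasoning

  1+n≤2n : ∀ {n} → 1 ≤ n → suc n ≤ 2 * n
  1+n≤2n {n} 1≤n = begin
    suc n     ≤⟨ +-monoˡ-≤ n 1≤n ⟩
    n + n     ≡⟨ solve (n ∷ []) ⟩
    2 * n     ∎
    where open ≤-Reasoning

  -- In a round of the growth argument, t is the number of current endpoints, b the number of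
  -- forbidden vertices, and z the number of new pivots.
  module _ {c : ℕ} (100≤c : 100 ≤ c) where

    ct≤7[z+b]⇒3ct≤28z : ∀ {t b z} → b ≤ 3 * t → c * t ≤ 7 * (z + b) → 3 * (c * t) ≤ 28 * z
    ct≤7[z+b]⇒3ct≤28z {t} {b} {z} b≤3t ct≤ = +-cancelʳ-≤ (c * t) (3 * (c * t)) (28 * z) (begin
      3 * (c * t) + c * t     ≡⟨ solve (c ∷ t ∷ []) ⟩
      4 * (c * t)             ≤⟨ *-monoʳ-≤ 4 ct≤ ⟩
      4 * (7 * (z + b))       ≡⟨ solve (z ∷ b ∷ []) ⟩
      28 * z + 28 * b         ≤⟨ +-monoʳ-≤ (28 * z) (*-monoʳ-≤ 28 b≤3t) ⟩
      28 * z + 28 * (3 * t)   ≤⟨ +-monoʳ-≤ (28 * z) (84t≤ct) ⟩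
      28 * z + c * t          ∎)
      where
      open ≤-Reasoning
      84t≤ct : 28 * (3 * t) ≤ c * t
      84t≤ct = subst (_≤ c * t) (*-assoc 28 3 t) (*-monoˡ-≤ t (≤-trans (m≤m+n 84 16) 100≤c))

    3ct≤28z⇒10t≤z : ∀ {t z} → 3 * (c * t) ≤ 28 * z → 10 * t ≤ z
    3ct≤28z⇒10t≤z {t} {z} 3ct≤ = *-cancelˡ-≤ 28 (begin
      28 * (10 * t)    ≡⟨ solve (t ∷ []) ⟩
      280 * t          ≤⟨ *-monoˡ-≤ t (m≤m+n 280 20) ⟩
      300 * t          ≡⟨ solve (t ∷ []) ⟩
      3 * (100 * t)    ≤⟨ *-monoʳ-≤ 3 (*-monoˡ-≤ t 100≤c) ⟩
      3 * (c * t)      ≤⟨ 3ct≤ ⟩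
      28 * z           ∎)
      where open ≤-Reasoning

    3ct≤28z⇒[1+c]t²≤z² : ∀ {t z} → 3 * (c * t) ≤ 28 * z → suc c * (t * t) ≤ z * z
    3ct≤28z⇒[1+c]t²≤z² {t} {z} 3ct≤ = *-cancelˡ-≤ 3 (begin
      3 * (suc c * (t * t))      ≡⟨ solve (c ∷ t ∷ []) ⟩
      (3 * (c * t) + 3 * t) * t  ≤⟨ *-monoˡ-≤ t (+-mono-≤ 3ct≤ 3t≤2z) ⟩
      (28 * z + 2 * z) * t       ≡⟨ solve (z ∷ t ∷ []) ⟩
      3 * z * (10 * t)           ≤⟨ *-monoʳ-≤ (3 * z) 10t≤z′ ⟩
      3 * z * z                  ≡⟨ *-assoc 3 z z ⟩
      3 * (z * z)                ∎)
      where
      open ≤-Reasoning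
      10t≤z′ = 3ct≤28z⇒10t≤z 3ct≤
      3t≤2z : 3 * t ≤ 2 * z
      3t≤2z = ≤-trans (*-monoˡ-≤ t (m≤m+n 3 7)) (≤-trans 10t≤z′ (m≤n*m z 2))

    3cm≤28z⇒[1+c][1+m]≤20z : ∀ {m z} → 1 ≤ m → 3 * (c * m) ≤ 28 * z → suc c * suc m ≤ 20 * z
    3cm≤28z⇒[1+c][1+m]≤20z {m} {z} 1≤m 3cm≤ = *-cancelˡ-≤ 300 (begin
      300 * (suc c * suc m)          ≡⟨ solve (c ∷ m ∷ []) ⟩
      3 * (100 * suc c) * suc m      ≤⟨ *-mono-≤ (*-monoʳ-≤ 3 100[1+c]≤101c) (1+n≤2n 1≤m) ⟩
      3 * (101 * c) * (2 * m)        ≡⟨ solve (c ∷ m ∷ []) ⟩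
      202 * (3 * (c * m))            ≤⟨ *-monoʳ-≤ 202 3cm≤ ⟩
      202 * (28 * z)                 ≡⟨ solve (z ∷ []) ⟩
      5656 * z                       ≤⟨ *-monoˡ-≤ z (m≤m+n 5656 344) ⟩
      6000 * z                       ≡⟨ solve (z ∷ []) ⟩
      300 * (20 * z)                 ∎)
      where
      open ≤-Reasoning
      100[1+c]≤101c : 100 * suc c ≤ 101 * c
      100[1+c]≤101c = begin
        100 * suc c    ≡⟨ solve (c ∷ []) ⟩
        100 + 100 * c  ≤⟨ +-monoˡ-≤ (100 * c) 100≤c ⟩
        c + 100 * c    ≡⟨ solve (c ∷ []) ⟩
        101 * c        ∎

    3cm≤28z⇒N≤100000z : ∀ {m z N} → 1 ≤ m → 3 * (c * m) ≤ 28 * z → N < 5000 * suc c * suc m →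
                        N ≤ 100000 * z
    3cm≤28z⇒N≤100000z {m} {z} {N} 1≤m 3cm≤ N< = <⇒≤ (begin-strict
      N                           <⟨ N< ⟩
      5000 * suc c * suc m        ≡⟨ *-assoc 5000 (suc c) (suc m) ⟩
      5000 * (suc c * suc m)      ≤⟨ *-monoʳ-≤ 5000 (3cm≤28z⇒[1+c][1+m]≤20z {m} {z} 1≤m 3cm≤) ⟩
      5000 * (20 * z)             ≡⟨ *-assoc 5000 20 z ⟨
      100000 * z                  ∎)
      where open ≤-Reasoning

    100000c≤N⇒5000[1+c]≤N : ∀ {N} → 100000 * c ≤ N → 5000 * suc c ≤ N
    100000c≤N⇒5000[1+c]≤N {N} 100000c≤N = begin
      5000 * suc c     ≤⟨ *-monoʳ-≤ 5000 (1+n≤2n (≤-trans (m≤m+n 1 99) 100≤c)) ⟩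
      5000 * (2 * c)   ≡⟨ solve (c ∷ []) ⟩
      10000 * c        ≤⟨ *-monoˡ-≤ c (m≤m+n 10000 90000) ⟩
      100000 * c       ≤⟨ 100000c≤N ⟩
      N                ∎
      where open ≤-Reasoning

  [1+c]^[2+i]≤n² : ∀ c i {t m N n} → suc c ^ i ≤ t * t → t ≤ m → 5000 * suc c * m ≤ N → N ≤ n →
                suc c ^ (2 + i) ≤ n * n
  [1+c]^[2+i]≤n² c i {t} {m} {N} {n} pow≤ t≤m Km≤N N≤n = begin
    suc c ^ (2 + i)                   ≡⟨ *-assoc (suc c) (suc c) (suc c ^ i) ⟨
    suc c * suc c * suc c ^ i         ≤⟨ *-monoʳ-≤ (suc c * suc c) (≤-trans pow≤ (*-mono-≤ t≤m t≤m)) ⟩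
    suc c * suc c * (m * m)           ≡⟨ solve (c ∷ m ∷ []) ⟩
    (suc c * m) * (suc c * m)         ≤⟨ *-mono-≤ cm≤n cm≤n ⟩
    n * n                             ∎
    where
    open ≤-Reasoning
    cm≤n : suc c * m ≤ n
    cm≤n = begin
      suc c * m             ≤⟨ *-monoˡ-≤ m (m≤n*m (suc c) 5000) ⟩
      5000 * suc c * m      ≤⟨ Km≤N ⟩
      N                     ≤⟨ N≤n ⟩
      n                     ∎

module RationalApproximation where

  open import Defs hiding (sym; irrefl)
  open import Data.Nat using (ℕ; zero; suc; _*_; _^_; _≤_; _<_)
  import Data.Nat.Properties as ℕP
  open import Data.Nat.DivMod using (_/_; m/n*n≤m; m*n/n≡m; /-monoˡ-≤)
  open import Data.Nat.Coprimality using (Coprime; 1-coprimeTo)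
  import Data.Nat.Coprimality as Coprimality
  open import Data.Integer as ℤ using (+_; -[1+_]; +≤+)
  import Data.Integer.Properties as ℤP
  open import Data.Rational as ℚ using (ℚ; mkℚ; *≤*; *<*)
  import Data.Rational.Properties as ℚP
  open import Data.Product using (∃-syntax; _×_; _,_)
  import Data.Product as Product
  open GrowthArithmetic using (m<[1+m/n]*n)
  open import Relation.Binary.PropositionalEquality
  open import Data.Bool using (true)
  open import Data.Fin using (Fin)
  open import Data.Fin.Subset using (Subset; _∈_; _∉_; _⊆_; ∣_∣)

  ℕ→ℚ≡mkℚ : ∀ a → ℕ→ℚ a ≡ mkℚ (+ a) 0 (Coprimality.sym (1-coprimeTo a))
  ℕ→ℚ≡mkℚ a = ℚP.normalize-coprime (Coprimality.sym (1-coprimeTo a))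

  module _ (a : ℕ) {k d-1 : ℕ} .{cop : Coprime k (suc d-1)} where

    private
      d = suc d-1
      q = mkℚ (+ k) d-1 cop

      +k*1≡+k : + k ℤ.* + 1 ≡ + k
      +k*1≡+k = ℤP.*-identityʳ (+ k)

    ℕ→ℚ-≤-frac : a * d ≤ k → ℕ→ℚ a ℚ.≤ q
    ℕ→ℚ-≤-frac h rewrite ℕ→ℚ≡mkℚ a = *≤* (subst₂ ℤ._≤_ (ℤP.pos-* a d) (sym +k*1≡+k) (+≤+ h))

    ℕ→ℚ-≤-frac⁻ : ℕ→ℚ a ℚ.≤ q → a * d ≤ k
    ℕ→ℚ-≤-frac⁻ h rewrite ℕ→ℚ≡mkℚ a with h
    ... | *≤* h′ = ℤP.drop‿+≤+ (subst₂ ℤ._≤_ (sym (ℤP.pos-* a d)) +k*1≡+k h′)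

    ℕ→ℚ-<-frac⁻ : ℕ→ℚ a ℚ.< q → a * d < k
    ℕ→ℚ-<-frac⁻ h rewrite ℕ→ℚ≡mkℚ a with h
    ... | *<* h′ = ℤP.drop‿+<+ (subst₂ ℤ._<_ (sym (ℤP.pos-* a d)) +k*1≡+k h′)

    frac-≤-ℕ→ℚ : k ≤ a * d → q ℚ.≤ ℕ→ℚ a
    frac-≤-ℕ→ℚ h rewrite ℕ→ℚ≡mkℚ a = *≤* (subst₂ ℤ._≤_ (sym +k*1≡+k) (ℤP.pos-* a d) (+≤+ h))

  ℕ→ℚ-mono-≤ : ∀ {a b} → a ≤ b → ℕ→ℚ a ℚ.≤ ℕ→ℚ b
  ℕ→ℚ-mono-≤ {a} {b} a≤b rewrite ℕ→ℚ≡mkℚ b =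
    ℕ→ℚ-≤-frac a (subst (_≤ b) (sym (ℕP.*-identityʳ a)) a≤b)

  ℕ→ℚ-cancel-≤ : ∀ {a b} → ℕ→ℚ a ℚ.≤ ℕ→ℚ b → a ≤ b
  ℕ→ℚ-cancel-≤ {a} {b} h rewrite ℕ→ℚ≡mkℚ b =
    subst (_≤ b) (ℕP.*-identityʳ a) (ℕ→ℚ-≤-frac⁻ a h)

  ℕ→ℚ-homo-* : ∀ a b → ℕ→ℚ (a * b) ≡ ℕ→ℚ a ℚ.* ℕ→ℚ b
  ℕ→ℚ-homo-* a b rewrite ℕ→ℚ≡mkℚ a | ℕ→ℚ≡mkℚ b = cong (ℚ._/ 1) (ℤP.pos-* a b)

  ℕ→ℚ-nonNeg : ∀ a → ℚ.NonNegative (ℕ→ℚ a)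
  ℕ→ℚ-nonNeg a rewrite ℕ→ℚ≡mkℚ a = _

  floor-above-100 : ∀ C → ℕ→ℚ 100 ℚ.< C →
                    ∃[ c ] (100 ≤ c × ℕ→ℚ c ℚ.≤ C × C ℚ.≤ ℕ→ℚ (suc c))
  floor-above-100 (mkℚ -[1+ k ] d-1 _) 100<C rewrite ℕ→ℚ≡mkℚ 100 with 100<C
  ... | *<* ()
  floor-above-100 (mkℚ (+ k) d-1 _) 100<C =
    k / d , 100≤k/d , ℕ→ℚ-≤-frac (k / d) (m/n*n≤m k d)
          , frac-≤-ℕ→ℚ (suc (k / d)) (ℕP.<⇒≤ (m<[1+m/n]*n k d))
    where
    d = suc d-1
    100≤k/d : 100 ≤ k / d
    100≤k/d = subst (_≤ k / d) (m*n/n≡m 100 d) (/-monoˡ-≤ d (ℕP.<⇒≤ (ℕ→ℚ-<-frac⁻ 100 100<C)))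

  module _ {p : ℚ} where

    ℕ→ℚ-*-≤ʳ : ∀ a b → ℕ→ℚ a ℚ.≤ p → ℕ→ℚ (a * b) ℚ.≤ p ℚ.* ℕ→ℚ b
    ℕ→ℚ-*-≤ʳ a b a≤p = ℚP.≤-trans (ℚP.≤-reflexive (ℕ→ℚ-homo-* a b))
                                   (ℚP.*-monoʳ-≤-nonNeg (ℕ→ℚ b) {{ℕ→ℚ-nonNeg b}} a≤p)

    ℕ→ℚ-*-≤ˡ : ∀ a b → ℕ→ℚ b ℚ.≤ p → ℕ→ℚ (a * b) ℚ.≤ ℕ→ℚ a ℚ.* p
    ℕ→ℚ-*-≤ˡ a b b≤p = ℚP.≤-trans (ℚP.≤-reflexive (ℕ→ℚ-homo-* a b))
                                   (ℚP.*-monoˡ-≤-nonNeg (ℕ→ℚ a) {{ℕ→ℚ-nonNeg a}} b≤p)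

    *-≤-ℕ→ℚ : ∀ {q} a b .{{p≥0 : ℚ.NonNegative p}} .{{q≥0 : ℚ.NonNegative q}} →
              p ℚ.≤ ℕ→ℚ a → q ℚ.≤ ℕ→ℚ b → p ℚ.* q ℚ.≤ ℕ→ℚ (a * b)
    *-≤-ℕ→ℚ {q} a b p≤a q≤b = begin
      p ℚ.* q             ≤⟨ ℚP.*-monoʳ-≤-nonNeg q p≤a ⟩
      ℕ→ℚ a ℚ.* q         ≤⟨ ℚP.*-monoˡ-≤-nonNeg (ℕ→ℚ a) {{ℕ→ℚ-nonNeg a}} q≤b ⟩
      ℕ→ℚ a ℚ.* ℕ→ℚ b     ≡⟨ ℕ→ℚ-homo-* a b ⟨
      ℕ→ℚ (a * b)         ∎
      where open ℚP.≤-Reasoning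

  ^ℚ-nonNeg : ∀ p .{{_ : ℚ.NonNegative p}} i → ℚ.NonNegative (p ^ℚ i)
  ^ℚ-nonNeg p zero    = _
  ^ℚ-nonNeg p (suc i) = ℚP.nonNeg*nonNeg⇒nonNeg p (p ^ℚ i) {{^ℚ-nonNeg p i}}

  ^ℚ-≤-ℕ→ℚ : ∀ {p} a .{{_ : ℚ.NonNegative p}} → p ℚ.≤ ℕ→ℚ a →
             ∀ i → p ^ℚ i ℚ.≤ ℕ→ℚ (a ^ i)
  ^ℚ-≤-ℕ→ℚ a p≤a zero    = ℚP.≤-refl
  ^ℚ-≤-ℕ→ℚ {p} a p≤a (suc i) =
    *-≤-ℕ→ℚ a (a ^ i) {{q≥0 = ^ℚ-nonNeg p i}} p≤a (^ℚ-≤-ℕ→ℚ a p≤a i)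

  ℕ→ℚ-≤⇒nonNeg : ∀ c {C} → ℕ→ℚ c ℚ.≤ C → ℚ.NonNegative C
  ℕ→ℚ-≤⇒nonNeg c c≤C =
    ℚ.nonNegative (ℚP.≤-trans (ℚP.nonNegative⁻¹ (ℕ→ℚ c) {{ℕ→ℚ-nonNeg c}}) c≤C)

  Expansion : ∀ {n} → Graph n → Subset n → (Fin n → Set) → ℕ → ℕ → Set
  Expansion {n} G U V K c =
    ∀ (X : Subset n) → X ⊆ U → K * ∣ X ∣ ≤ ∣ U ∣ →
    ∃[ S ] ((∀ w → w ∈ S → w ∉ X × (∃[ x ] (x ∈ X × adj G x w ≡ true)) × V w)
            × c * ∣ X ∣ ≤ ∣ S ∣)

  expansion-ℕ : ∀ {n} (G : Graph n) U V {C} c → ℕ→ℚ c ℚ.≤ C → C ℚ.≤ ℕ→ℚ (suc c) →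
                Expands G C U V → Expansion G U V (5000 * suc c) c
  expansion-ℕ G U V {C} c c≤C C≤1+c (_ , expands) X X⊆U KX≤U =
    Product.map₂ (Product.map₂ scale) (expands X X⊆U 5000CX≤U)
    where
    scale : ∀ {s} → C ℚ.* ℕ→ℚ ∣ X ∣ ℚ.≤ ℕ→ℚ s → c * ∣ X ∣ ≤ s
    scale CX≤s = ℕ→ℚ-cancel-≤ (ℚP.≤-trans (ℕ→ℚ-*-≤ʳ c ∣ X ∣ c≤C) CX≤s)
    instance
      C≥0 : ℚ.NonNegative C
      C≥0 = ℕ→ℚ-≤⇒nonNeg c c≤C
    5000CX≤U : ℕ→ℚ 5000 ℚ.* C ℚ.* ℕ→ℚ ∣ X ∣ ℚ.≤ ℕ→ℚ ∣ U ∣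
    5000CX≤U = begin
      ℕ→ℚ 5000 ℚ.* C ℚ.* ℕ→ℚ ∣ X ∣
        ≤⟨ *-≤-ℕ→ℚ (5000 * suc c) ∣ X ∣ {{5000C≥0}} {{ℕ→ℚ-nonNeg ∣ X ∣}} 5000C≤K ℚP.≤-refl ⟩
      ℕ→ℚ (5000 * suc c * ∣ X ∣)    ≤⟨ ℕ→ℚ-mono-≤ KX≤U ⟩
      ℕ→ℚ ∣ U ∣                      ∎
      where
      open ℚP.≤-Reasoning
      5000C≥0 = ℚP.nonNeg*nonNeg⇒nonNeg (ℕ→ℚ 5000) {{ℕ→ℚ-nonNeg 5000}} C
      5000C≤K = *-≤-ℕ→ℚ 5000 (suc c) {{ℕ→ℚ-nonNeg 5000}} ℚP.≤-refl C≤1+c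

module AtMost where

  open import Data.Product using (_×_; _,_)
  open import Data.Sum using (_⊎_; inj₁; inj₂)
  open import Relation.Binary.PropositionalEquality
  open import Relation.Nullary using (contradiction)

  AtMostOne : ∀ {A : Set} → (A → Set) → Set
  AtMostOne P = ∀ {a b} → P a → P b → a ≡ b

  AtMostTwo : ∀ {A : Set} → (A → Set) → Set
  AtMostTwo P = ∀ {a b c} → P a → P b → P c → a ≡ b ⊎ a ≡ c ⊎ b ≡ c

  module _ {A : Set} where

    atMostOne-const : ∀ {P : A → Set} t → (∀ {b} → P b → b ≡ t) → AtMostOne P
    atMostOne-const t ≡t pa pb = trans (≡t pa) (sym (≡t pb))

    ≡-atMostOne : ∀ {t : A} → AtMostOne (_≡ t)
    ≡-atMostOne a≡t b≡t = trans a≡t (sym b≡t)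

    atMostTwo-⊎ : ∀ {P Q R : A → Set} → AtMostOne P → AtMostOne Q →
                  (∀ {b} → R b → P b ⊎ Q b) → AtMostTwo R
    atMostTwo-⊎ {P} {Q} oneP oneQ split ra rb rc = go (split ra) (split rb) (split rc)
      where
      go : ∀ {a b c} → P a ⊎ Q a → P b ⊎ Q b → P c ⊎ Q c → a ≡ b ⊎ a ≡ c ⊎ b ≡ c
      go (inj₁ pa) (inj₁ pb) _         = inj₁ (oneP pa pb)
      go (inj₁ pa) (inj₂ _)  (inj₁ pc) = inj₂ (inj₁ (oneP pa pc))
      go (inj₁ _)  (inj₂ qb) (inj₂ qc) = inj₂ (inj₂ (oneQ qb qc))
      go (inj₂ _)  (inj₁ pb) (inj₁ pc) = inj₂ (inj₂ (oneP pb pc))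
      go (inj₂ qa) (inj₁ _)  (inj₂ qc) = inj₂ (inj₁ (oneQ qa qc))
      go (inj₂ qa) (inj₂ qb) _         = inj₁ (oneQ qa qb)

    atMostOne-others : ∀ {P : A → Set} {t} → AtMostTwo P → P t → AtMostOne (λ b → P b × b ≢ t)
    atMostOne-others two pt (pa , a≢t) (pb , b≢t) with two pa pb pt
    ... | inj₁ a≡b        = a≡b
    ... | inj₂ (inj₁ a≡t) = contradiction a≡t a≢t
    ... | inj₂ (inj₂ b≡t) = contradiction b≡t b≢t

module ListsAndSubsets where

  open import Data.Nat using (ℕ; suc; _+_; _*_; _≤_; z≤n; s≤s)
  import Data.Nat.Properties as ℕP
  open import Data.Fin as Fin using (Fin; _≟_)
  import Data.Fin.Properties as FinP
  open import Data.Fin.Subset using (Subset; inside; outside; ∣_∣) renaming (_∈_ to _∈ₛ_)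
  open import Data.Vec as Vec using (_∷_; []; tabulate)
  import Data.Vec.Properties as VecP
  open import Data.List using (List; []; _∷_; length; map; concatMap; lookup; _++_)
  import Data.List.Properties as ListP
  open import Data.List.Membership.Propositional using (_∈_)
  open import Data.List.Membership.Propositional.Properties using (∈-lookup; ∈-map⁺; ∈-map⁻)
  open import Data.List.Relation.Binary.Subset.Propositional using (_⊆_)
  open import Data.List.Relation.Unary.All as All using (All; []; _∷_)
  import Data.List.Relation.Unary.All.Properties as AllP
  open import Data.List.Relation.Unary.Any as Any using (here; there)
  open import Data.List.Relation.Unary.Any.Properties using (lookup-index)
  open import Data.List.Relation.Unary.AllPairs using ([]; _∷_)
  open import Data.List.Relation.Unary.Unique.Propositional using (Unique)
  import Data.List.Relation.Unary.Unique.Propositional.Properties as UniqueP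
  open import Data.Product using (_,_)
  open import Data.Sum using (inj₁; inj₂)
  open import Relation.Binary.PropositionalEquality
  open import Relation.Nullary using (yes; does; contradiction)
  open import Relation.Nullary.Decidable using (dec-true)
  open import Relation.Unary using (Decidable)
  open AtMost using (AtMostTwo)

  module _ {A : Set} where

    lookup-injective : ∀ {xs : List A} → Unique xs → ∀ {i j} → lookup xs i ≡ lookup xs j → i ≡ j
    lookup-injective (_  ∷ _) {Fin.zero}  {Fin.zero}  _  = refl
    lookup-injective (x∉ ∷ _) {Fin.zero}  {Fin.suc j} eq = contradiction eq (All.lookup x∉ (∈-lookup j))
    lookup-injective (x∉ ∷ _) {Fin.suc i} {Fin.zero}  eq = contradiction (sym eq) (All.lookup x∉ (∈-lookup i))
    lookup-injective (_  ∷ u) {Fin.suc i} {Fin.suc j} eq = cong Fin.suc (lookup-injective u eq)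

    unique⊆⇒length≤ : ∀ {xs ys : List A} → Unique xs → xs ⊆ ys → length xs ≤ length ys
    unique⊆⇒length≤ {xs} {ys} u xs⊆ys = FinP.injective⇒≤ position-injective
      where
      position : Fin (length xs) → Fin (length ys)
      position i = Any.index (xs⊆ys (∈-lookup i))
      position-injective : ∀ {i j} → position i ≡ position j → i ≡ j
      position-injective {i} {j} eq = lookup-injective u (begin
        lookup xs i               ≡⟨ lookup-index (xs⊆ys (∈-lookup i)) ⟩
        lookup ys (position i)    ≡⟨ cong (lookup ys) eq ⟩
        lookup ys (position j)    ≡⟨ lookup-index (xs⊆ys (∈-lookup j)) ⟨
        lookup xs j               ∎)
        where open ≡-Reasoning

    unique⇒length≤2 : ∀ {xs : List A} → Unique xs → AtMostTwo (_∈ xs) → length xs ≤ 2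
    unique⇒length≤2 {[]}                 _ _ = z≤n
    unique⇒length≤2 {_ ∷ []}             _ _ = s≤s z≤n
    unique⇒length≤2 {_ ∷ _ ∷ []}         _ _ = s≤s (s≤s z≤n)
    unique⇒length≤2 {a ∷ b ∷ c ∷ _} ((a≢b ∷ a≢c ∷ _) ∷ (b≢c ∷ _) ∷ _) two
      with two (here refl) (there (here refl)) (there (there (here refl)))
    ... | inj₁ a≡b        = contradiction a≡b a≢b
    ... | inj₂ (inj₁ a≡c) = contradiction a≡c a≢c
    ... | inj₂ (inj₂ b≡c) = contradiction b≡c b≢c

    length-concatMap≤ : ∀ (f : A → List A) {k} xs → (∀ x → length (f x) ≤ k) →
                        length (concatMap f xs) ≤ k * length xs
    length-concatMap≤ f {k} []       _  = z≤n
    length-concatMap≤ f {k} (x ∷ xs) fk = begin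
      length (f x ++ concatMap f xs)      ≡⟨ ListP.length-++ (f x) ⟩
      length (f x) + length (concatMap f xs) ≤⟨ ℕP.+-mono-≤ (fk x) (length-concatMap≤ f xs fk) ⟩
      k + k * length xs                   ≡⟨ ℕP.*-suc k (length xs) ⟨
      k * suc (length xs)                 ∎
      where open ℕP.≤-Reasoning

  toList : ∀ {n} → Subset n → List (Fin n)
  toList []              = []
  toList (inside  ∷ p) = Fin.zero ∷ map Fin.suc (toList p)
  toList (outside ∷ p) = map Fin.suc (toList p)

  length-toList : ∀ {n} (p : Subset n) → length (toList p) ≡ ∣ p ∣
  length-toList []            = refl
  length-toList (inside  ∷ p) = cong suc (trans (ListP.length-map Fin.suc (toList p)) (length-toList p))
  length-toList (outside ∷ p) = trans (ListP.length-map Fin.suc (toList p)) (length-toList p)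

  toList-unique : ∀ {n} (p : Subset n) → Unique (toList p)
  toList-unique []            = []
  toList-unique (inside  ∷ p) =
    AllP.map⁺ (All.universal (λ _ ()) (toList p)) ∷ UniqueP.map⁺ FinP.suc-injective (toList-unique p)
  toList-unique (outside ∷ p) = UniqueP.map⁺ FinP.suc-injective (toList-unique p)

  ∈-toList⁺ : ∀ {n} {p : Subset n} {x} → x ∈ₛ p → x ∈ toList p
  ∈-toList⁺ {p = inside  ∷ p} Vec.here      = here refl
  ∈-toList⁺ {p = inside  ∷ p} (Vec.there m) = there (∈-map⁺ Fin.suc (∈-toList⁺ m))
  ∈-toList⁺ {p = outside ∷ p} (Vec.there m) = ∈-map⁺ Fin.suc (∈-toList⁺ m)

  ∈-toList⁻ : ∀ {n} {p : Subset n} {x} → x ∈ toList p → x ∈ₛ p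
  ∈-toList⁻ {p = inside ∷ p} (here refl) = Vec.here
  ∈-toList⁻ {p = inside ∷ p} (there m) with ∈-map⁻ Fin.suc m
  ... | _ , m′ , refl = Vec.there (∈-toList⁻ m′)
  ∈-toList⁻ {p = outside ∷ p} m with ∈-map⁻ Fin.suc m
  ... | _ , m′ , refl = Vec.there (∈-toList⁻ m′)

  module _ {n : ℕ} where

    open import Data.List.Membership.DecPropositional (_≟_ {n}) using (_∈?_)

    toSubset : {P : Fin n → Set} → Decidable P → Subset n
    toSubset P? = tabulate (λ x → does (P? x))

    ∈-toSubset⁺ : ∀ {P : Fin n → Set} (P? : Decidable P) {x} → P x → x ∈ₛ toSubset P?
    ∈-toSubset⁺ P? {x} px = VecP.lookup⇒[]= x _ (trans (VecP.lookup∘tabulate _ x) (dec-true (P? x) px))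

    ∈-toSubset⁻ : ∀ {P : Fin n → Set} (P? : Decidable P) {x} → x ∈ₛ toSubset P? → P x
    ∈-toSubset⁻ P? {x} x∈ with P? x | trans (sym (VecP.lookup∘tabulate _ x)) (VecP.[]=⇒lookup x∈)
    ... | yes px | _ = px

    fromList : List (Fin n) → Subset n
    fromList xs = toSubset (_∈? xs)

    ∈-fromList⁺ : ∀ {xs x} → x ∈ xs → x ∈ₛ fromList xs
    ∈-fromList⁺ {xs} = ∈-toSubset⁺ (_∈? xs)

    ∈-fromList⁻ : ∀ {xs x} → x ∈ₛ fromList xs → x ∈ xs
    ∈-fromList⁻ {xs} = ∈-toSubset⁻ (_∈? xs)

    ∣fromList∣≡length : ∀ {xs : List (Fin n)} → Unique xs → ∣ fromList xs ∣ ≡ length xs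
    ∣fromList∣≡length {xs = xs} u = ℕP.≤-antisym
      (subst (_≤ length xs) (length-toList (fromList xs))
        (unique⊆⇒length≤ (toList-unique (fromList xs)) (λ m → ∈-fromList⁻ {xs} (∈-toList⁻ m))))
      (subst (length xs ≤_) (length-toList (fromList xs))
        (unique⊆⇒length≤ u (λ m → ∈-toList⁺ (∈-fromList⁺ {xs} m))))

module DegreeTwoGraphs where

  open import Defs hiding (sym; irrefl)
  open AtMost
  open import Data.Bool using (true; false)
  open import Data.Nat using (ℕ)
  open import Data.Fin using (Fin; _≟_)
  open import Data.Product using (_×_; _,_; proj₁)
  open import Data.Sum using (_⊎_; inj₁; inj₂)
  open import Relation.Binary.PropositionalEquality
  open import Relation.Nullary using (¬_; Dec; yes; no; proof; contradiction; Reflects; ofʸ; ofⁿ)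
  open import Relation.Nullary.Decidable using (_×-dec_; _⊎-dec_; isYes≗does)

  module _ {n : ℕ} where

    Nbr : Edges n → Fin n → Fin n → Set
    Nbr E a b = E a b ≡ true

    SamePair : Fin n → Fin n → Fin n → Fin n → Set
    SamePair a b c d = (a ≡ c × b ≡ d) ⊎ (a ≡ d × b ≡ c)

    -- Defs writes samePair with ⌊_⌋; rewriting ⌊_⌋ to does turns it into the Boolean of a decision.
    samePair-reflects : ∀ a b c d → Reflects (SamePair a b c d) (samePair a b c d)
    samePair-reflects a b c d
      rewrite isYes≗does (a ≟ c) | isYes≗does (b ≟ d) | isYes≗does (a ≟ d) | isYes≗does (b ≟ c) =
      proof ((a ≟ c ×-dec b ≟ d) ⊎-dec (a ≟ d ×-dec b ≟ c))

    samePair-sym : ∀ {a b c d} → SamePair a b c d → SamePair b a c d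
    samePair-sym (inj₁ (a≡c , b≡d)) = inj₂ (b≡d , a≡c)
    samePair-sym (inj₂ (a≡d , b≡c)) = inj₁ (b≡c , a≡d)

    record IsDegree≤2 (E : Edges n) : Set where
      field
        symmetric   : ∀ {a b} → Nbr E a b → Nbr E b a
        irreflexive : ∀ {a} → ¬ Nbr E a a
        degree≤2    : ∀ a → AtMostTwo (Nbr E a)

    module Rotate (E : Edges n) (x y z : Fin n) where

      R : Edges n
      R = rotate E x y z

      nbr⁻ : ∀ {a b} → Nbr R a b → SamePair a b x z ⊎ (¬ SamePair a b y z × Nbr E a b)
      nbr⁻ {a} {b} e with samePair a b x z | samePair-reflects a b x z
      ... | true  | ofʸ new = inj₁ new
      ... | false | ofⁿ _ with samePair a b y z | samePair-reflects a b y z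
      ...   | false | ofⁿ ¬old = inj₂ (¬old , e)

      nbr-new : ∀ {a b} → SamePair a b x z → Nbr R a b
      nbr-new {a} {b} new with samePair a b x z | samePair-reflects a b x z
      ... | true  | _       = refl
      ... | false | ofⁿ ¬new = contradiction new ¬new

      nbr-old : ∀ {a b} → ¬ SamePair a b y z → Nbr E a b → Nbr R a b
      nbr-old {a} {b} ¬old e with samePair a b x z
      ... | true  = refl
      ... | false with samePair a b y z | samePair-reflects a b y z
      ...   | true  | ofʸ old = contradiction old ¬old
      ...   | false | _       = e

      rotate-away : ∀ {a} → a ≢ x → a ≢ y → a ≢ z → ∀ b → R a b ≡ E a b
      rotate-away {a} a≢x a≢y a≢z b with samePair a b x z | samePair-reflects a b x z
      ... | true  | ofʸ (inj₁ (a≡x , _)) = contradiction a≡x a≢x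
      ... | true  | ofʸ (inj₂ (a≡z , _)) = contradiction a≡z a≢z
      ... | false | _ with samePair a b y z | samePair-reflects a b y z
      ...   | true  | ofʸ (inj₁ (a≡y , _)) = contradiction a≡y a≢y
      ...   | true  | ofʸ (inj₂ (a≡z , _)) = contradiction a≡z a≢z
      ...   | false | _                    = refl

      nbr-at-x : x ≢ z → ∀ {b} → Nbr R x b → b ≡ z ⊎ Nbr E x b
      nbr-at-x x≢z e with nbr⁻ e
      ... | inj₁ (inj₁ (_ , b≡z))   = inj₁ b≡z
      ... | inj₁ (inj₂ (x≡z , _))   = contradiction x≡z x≢z
      ... | inj₂ (_ , old)          = inj₂ old

      nbr-at-z : x ≢ z → ∀ {b} → Nbr R z b → b ≡ x ⊎ (Nbr E z b × b ≢ y)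
      nbr-at-z x≢z e with nbr⁻ e
      ... | inj₁ (inj₁ (z≡x , _))   = contradiction (sym z≡x) x≢z
      ... | inj₁ (inj₂ (_ , b≡x))   = inj₁ b≡x
      ... | inj₂ (¬old , old)       = inj₂ (old , λ b≡y → ¬old (inj₂ (refl , b≡y)))

      nbr-elsewhere : ∀ {a b} → a ≢ x → a ≢ z → Nbr R a b → Nbr E a b × ¬ SamePair a b y z
      nbr-elsewhere a≢x a≢z e with nbr⁻ e
      ... | inj₁ (inj₁ (a≡x , _))   = contradiction a≡x a≢x
      ... | inj₁ (inj₂ (a≡z , _))   = contradiction a≡z a≢z
      ... | inj₂ (¬old , old)       = old , ¬old

    NewEndpoint : Edges n → Fin n → Fin n → Set
    NewEndpoint E z y = Nbr E z y ⊎ ((∀ w → E z w ≡ false) × y ≡ z)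

    module _ {E : Edges n} (deg : IsDegree≤2 E) {x y z : Fin n} (x≢z : x ≢ z)
             (x-end : AtMostOne (Nbr E x)) where

      open IsDegree≤2 deg
      open Rotate E x y z

      private
        isolated : (∀ w → E z w ≡ false) → ∀ {b} → ¬ Nbr E z b
        isolated iso zb = contradiction (trans (sym (iso _)) zb) λ ()

        nbrs-of-z-but-y : NewEndpoint E z y → AtMostOne (λ b → Nbr E z b × b ≢ y)
        nbrs-of-z-but-y (inj₁ zy)                   = atMostOne-others (degree≤2 z) zy
        nbrs-of-z-but-y (inj₂ (iso , _)) (zb , _) _ = contradiction zb (isolated iso)

        degree≤2-at : NewEndpoint E z y → ∀ a → Dec (a ≡ x) → Dec (a ≡ z) → AtMostTwo (Nbr R a)
        degree≤2-at _  a (yes refl) _          = atMostTwo-⊎ ≡-atMostOne x-end (nbr-at-x x≢z)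
        degree≤2-at ch a (no _)     (yes refl) = atMostTwo-⊎ ≡-atMostOne (nbrs-of-z-but-y ch) (nbr-at-z x≢z)
        degree≤2-at _  a (no a≢x)   (no a≢z) pb pc pd = degree≤2 a (old pb) (old pc) (old pd)
          where
          old : ∀ {b} → Nbr R a b → Nbr E a b
          old e = proj₁ (nbr-elsewhere a≢x a≢z e)

        symmetric′ : ∀ {a b} → SamePair a b x z ⊎ (¬ SamePair a b y z × Nbr E a b) → Nbr R b a
        symmetric′ (inj₁ new)          = nbr-new (samePair-sym new)
        symmetric′ (inj₂ (¬old , old)) = nbr-old (λ old′ → ¬old (samePair-sym old′)) (symmetric old)

        irreflexive′ : ∀ {a} → ¬ (SamePair a a x z ⊎ (¬ SamePair a a y z × Nbr E a a))
        irreflexive′ (inj₁ (inj₁ (a≡x , a≡z))) = x≢z (trans (sym a≡x) a≡z)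
        irreflexive′ (inj₁ (inj₂ (a≡z , a≡x))) = x≢z (trans (sym a≡x) a≡z)
        irreflexive′ (inj₂ (_ , loop))         = irreflexive loop

      rotate-isDegree≤2 : NewEndpoint E z y → IsDegree≤2 R
      rotate-isDegree≤2 ch = record
        { symmetric   = λ {a} {b} e → symmetric′ (nbr⁻ {a} {b} e)
        ; irreflexive = λ {a} e → irreflexive′ (nbr⁻ {a} {a} e)
        ; degree≤2    = λ a → degree≤2-at ch a (a ≟ x) (a ≟ z)
        }

      rotate-newEndpoint : NewEndpoint E z y → AtMostOne (Nbr R y)
      rotate-newEndpoint (inj₂ (iso , y≡z)) = atMostOne-const x only-x
        where
        only-x : ∀ {b} → Nbr R y b → b ≡ x
        only-x e with nbr-at-z x≢z (subst (λ u → Nbr R u _) y≡z e)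
        ... | inj₁ b≡x      = b≡x
        ... | inj₂ (zb , _) = contradiction zb (isolated iso)
      rotate-newEndpoint (inj₁ zy) = from (y ≟ x)
        where
        from : Dec (y ≡ x) → AtMostOne (Nbr R y)
        from (yes y≡x) = atMostOne-const z only-z
          where
          only-z : ∀ {b} → Nbr R y b → b ≡ z
          only-z e with nbr-at-x x≢z (subst (λ u → Nbr R u _) y≡x e)
          ... | inj₁ b≡z = b≡z
          ... | inj₂ xb  = x-end xb (symmetric (subst (Nbr E z) y≡x zy))
        from (no y≢x) e e′ = atMostOne-others (degree≤2 y) (symmetric zy) (not-z e) (not-z e′)
          where
          y≢z : y ≢ z
          y≢z y≡z = irreflexive (subst (Nbr E z) y≡z zy)
          not-z : ∀ {b} → Nbr R y b → Nbr E y b × b ≢ z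
          not-z e with nbr-elsewhere y≢x y≢z e
          ... | yb , ¬old = yb , λ b≡z → ¬old (inj₁ (refl , b≡z))

module LinearForests where

  open import Defs hiding (sym; irrefl)
  open import Data.Fin.Subset using (Subset)
  open AtMost using (AtMostOne; atMostTwo-⊎)
  open DegreeTwoGraphs
  open import Data.Nat using (ℕ)
  open import Data.Fin using (Fin)
  open import Data.List using (List; []; _∷_; _++_; concat)
  open import Data.List.Membership.Propositional using (_∈_)
  open import Data.List.Relation.Unary.Any using (here; there)
  open import Data.List.Relation.Unary.All.Properties using (All¬⇒¬Any)
  open import Data.List.Relation.Unary.AllPairs using ([]; _∷_)
  open import Data.List.Relation.Unary.Unique.Propositional using (Unique)
  open import Data.Product using (_,_)
  open import Data.Sum using (_⊎_; [_,_]′)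
  import Data.Sum as Sum
  open import Function.Bundles using (Equivalence)
  open import Relation.Binary.PropositionalEquality
  open import Relation.Nullary using (¬_; contradiction)

  module _ {n : ℕ} where

    private
      variable
        a b u w : Fin n
        l p : List (Fin n)

    consec-fst : Consec a b l → a ∈ l
    consec-fst here      = here refl
    consec-fst (there c) = there (consec-fst c)

    consec-snd : Consec a b (u ∷ l) → b ∈ l
    consec-snd here               = here refl
    consec-snd (there c@here)      = there (consec-snd c)
    consec-snd (there c@(there _)) = there (consec-snd c)

    consec-++ˡ : ∀ q → Consec a b p → Consec a b (p ++ q)
    consec-++ˡ q here      = here
    consec-++ˡ q (there c) = there (consec-++ˡ q c)

    consec-++ʳ : ∀ p {q} → Consec a b q → Consec a b (p ++ q)
    consec-++ʳ []      c = c
    consec-++ʳ (_ ∷ p) c = there (consec-++ʳ p c)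

    consec-concat : ∀ {ps} → p ∈ ps → Consec a b p → Consec a b (concat ps)
    consec-concat {ps = q ∷ ps} (here refl) c = consec-++ˡ (concat ps) c
    consec-concat {ps = q ∷ ps} (there m)   c = consec-++ʳ q (consec-concat m c)

    consec-irreflexive : Unique l → ¬ Consec a a l
    consec-irreflexive (a∉ ∷ _)   here      = All¬⇒¬Any a∉ (here refl)
    consec-irreflexive (_ ∷ uniq) (there c) = consec-irreflexive uniq c

    successor-unique : Unique l → AtMostOne (λ b → Consec a b l)
    successor-unique _          here      here       = refl
    successor-unique (a∉ ∷ _)   here      (there c)  = contradiction (consec-fst c) (All¬⇒¬Any a∉)
    successor-unique (a∉ ∷ _)   (there c) here       = contradiction (consec-fst c) (All¬⇒¬Any a∉)
    successor-unique (_ ∷ uniq) (there c) (there c′) = successor-unique uniq c c′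

    predecessor-unique : Unique l → AtMostOne (λ b → Consec b a l)
    predecessor-unique _                here      here       = refl
    predecessor-unique (_ ∷ (a∉ ∷ _))   here      (there c)  = contradiction (consec-snd c) (All¬⇒¬Any a∉)
    predecessor-unique (_ ∷ (a∉ ∷ _))   (there c) here       = contradiction (consec-snd c) (All¬⇒¬Any a∉)
    predecessor-unique (_ ∷ uniq)       (there c) (there c′) = predecessor-unique uniq c c′

  module _ {n : ℕ} {G : Graph n} {vs : Subset n} {F : Edges n} (lf : IsLinearForest G vs F) where

    open IsLinearForest lf

    private
      nbr-consec : ∀ {a b} → Nbr F a b → Consec a b (concat paths) ⊎ Consec b a (concat paths)
      nbr-consec {a} {b} e with Equivalence.to (edges a b) e
      ... | _ , p∈ , c = Sum.map (consec-concat p∈) (consec-concat p∈) c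

    linearForest-isDegree≤2 : IsDegree≤2 F
    linearForest-isDegree≤2 = record
      { symmetric   = symmetric
      ; irreflexive = λ e → [ consec-irreflexive disjoint , consec-irreflexive disjoint ]′ (nbr-consec e)
      ; degree≤2    = λ a → atMostTwo-⊎ (successor-unique disjoint) (predecessor-unique disjoint) nbr-consec
      }
      where
      symmetric : ∀ {a b} → Nbr F a b → Nbr F b a
      symmetric {a} {b} e with Equivalence.to (edges a b) e
      ... | p , p∈ , c = Equivalence.from (edges b a) (p , p∈ , Sum.swap c)

module Reachability where

  open import Defs hiding (sym; irrefl)
  open ListsAndSubsets using (toSubset; ∈-toSubset⁺; ∈-toSubset⁻)
  open DegreeTwoGraphs using (Nbr)
  open import Data.Bool using (true)
  import Data.Bool.Properties as BoolP
  open import Data.Nat using (ℕ; zero; suc; _≤_; z≤n; s≤s)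
  import Data.Nat.Properties as ℕP
  open import Data.Fin using (Fin; _≟_)
  import Data.Fin.Properties as FinP
  open import Data.Fin.Subset using (Subset; _∈_; _⊆_; ∣_∣)
  open import Data.Fin.Subset.Properties using (_⊂?_; _∈?_; p⊂q⇒∣p∣<∣q∣; ∣p∣≤n)
  open import Data.Product using (∃-syntax; _×_; _,_)
  open import Data.Sum using (_⊎_; inj₁; inj₂)
  open import Relation.Binary.Construct.Closure.ReflexiveTransitive using (ε; _◅_; _◅◅_)
  open import Relation.Binary.PropositionalEquality
  open import Relation.Nullary using (Dec; yes; no; contradiction)
  open import Relation.Nullary.Decidable using (_⊎-dec_; _×-dec_)
  open import Relation.Unary using (Decidable)

  -- An increasing chain of subsets of Fin n cannot grow strictly n + 1 times in a row.
  ⊆-chain-stabilises : ∀ {n} (R : ℕ → Subset n) → (∀ k → R k ⊆ R (suc k)) → ∃[ k ] R (suc k) ⊆ R k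
  ⊆-chain-stabilises {n} R chain with grows (suc n)
    where
    grows : ∀ k → (∃[ j ] R (suc j) ⊆ R j) ⊎ k ≤ ∣ R k ∣
    grows zero = inj₂ z≤n
    grows (suc k) with grows k
    ... | inj₁ stable = inj₁ stable
    ... | inj₂ k≤ with R k ⊂? R (suc k)
    ...   | yes R⊂ = inj₂ (ℕP.≤-trans (s≤s k≤) (p⊂q⇒∣p∣<∣q∣ R⊂))
    ...   | no ¬R⊂ = inj₁ (k , λ {x} x∈ → stays x∈ (x ∈? R k))
      where
      stays : ∀ {x} → x ∈ R (suc k) → Dec (x ∈ R k) → x ∈ R k
      stays _  (yes x∈) = x∈
      stays x∈ (no x∉)  = contradiction ((λ {_} → chain k) , _ , x∈ , x∉) ¬R⊂
  ... | inj₁ stable = stable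
  ... | inj₂ big    = contradiction (ℕP.≤-trans big (∣p∣≤n (R (suc n)))) ℕP.1+n≰n

  module _ {n : ℕ} (E : Edges n) (a : Fin n) where

    Within : ℕ → Fin n → Set
    Within zero    b = a ≡ b
    Within (suc k) b = Within k b ⊎ ∃[ u ] (Within k u × Nbr E u b)

    within? : ∀ k → Decidable (Within k)
    within? zero    b = a ≟ b
    within? (suc k) b = within? k b ⊎-dec FinP.any? (λ u → within? k u ×-dec (E u b BoolP.≟ true))

    within-start : ∀ k → Within k a
    within-start zero    = refl
    within-start (suc k) = inj₁ (within-start k)

    within⇒reach : ∀ k {b} → Within k b → Reach E a b
    within⇒reach zero    refl               = ε
    within⇒reach (suc k) (inj₁ w)           = within⇒reach k w
    within⇒reach (suc k) (inj₂ (_ , w , e)) = within⇒reach k w ◅◅ (e ◅ ε)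

    private
      reached : ℕ → Subset n
      reached k = toSubset (within? k)

      stable : ∃[ k ] (∀ {b} → Within (suc k) b → Within k b)
      stable with ⊆-chain-stabilises reached
                    (λ k x∈ → ∈-toSubset⁺ (within? (suc k)) (inj₁ (∈-toSubset⁻ (within? k) x∈)))
      ... | k , shrink = k , λ w → ∈-toSubset⁻ (within? k) (shrink (∈-toSubset⁺ (within? (suc k)) w))

    reach? : Decidable (Reach E a)
    reach? b with stable
    ... | k , closed with within? k b
    ...   | yes w = yes (within⇒reach k w)
    ...   | no ¬w = no (λ r → ¬w (extend (within-start k) r))
      where
      extend : ∀ {u} → Within k u → Reach E u b → Within k b
      extend w ε       = w
      extend w (e ◅ r) = extend (closed (inj₂ (_ , w , e))) r

  first-entry : ∀ {n} {E : Edges n} {x z} → Reach E x z → x ≢ z →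
                ∃[ y ] (Nbr E y z × ReachAvoid E z x y)
  first-entry ε x≢z = contradiction refl x≢z
  first-entry {x = x} {z} (_◅_ {j = u} e r) x≢z with u ≟ z
  ... | yes refl = x , e , ε
  ... | no u≢z with first-entry r u≢z
  ...   | y , yz , avoid = y , yz , (e , x≢z , u≢z) ◅ avoid

module FarApartPivots where

  open import Defs hiding (sym; irrefl)
  open ListsAndSubsets
  open DegreeTwoGraphs using (Nbr; IsDegree≤2)
  open import Data.Bool using (true)
  import Data.Bool.Properties as BoolP
  open import Data.Nat using (ℕ; _+_; _*_; _≤_; s≤s)
  import Data.Nat.Properties as ℕP
  open import Data.Fin using (Fin; _≟_)
  import Data.Fin.Properties as FinP
  open import Data.List using (List; []; _∷_; _++_; filter; concatMap; allFin; length)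
  import Data.List.Properties as ListP
  open import Data.List.Membership.Propositional using (_∈_)
  open import Data.List.Membership.Propositional.Properties
    using (∈-filter⁺; ∈-filter⁻; ∈-allFin; ∈-++⁺ˡ; ∈-++⁺ʳ; ∈-concatMap⁺)
  open import Data.List.Relation.Binary.Subset.Propositional using (_⊆_)
  open import Data.List.Relation.Binary.Permutation.Propositional.Properties using (Any-resp-↭; shift)
  open import Data.List.Relation.Unary.All as All using (All; []; _∷_)
  open import Data.List.Relation.Unary.All.Properties using (¬Any⇒All¬)
  open import Data.List.Relation.Unary.AllPairs using (AllPairs; []; _∷_)
  open import Data.List.Relation.Unary.Any as Any using (Any; here; there; any?)
  import Data.List.Relation.Unary.Any.Properties as AnyP
  open import Data.List.Relation.Unary.Unique.Propositional using (Unique)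
  import Data.List.Relation.Unary.Unique.Propositional.Properties as UniqueP
  open import Data.Product using (_,_; proj₂)
  open import Data.Sum using (inj₁; inj₂)
  open import Relation.Binary.PropositionalEquality
  open import Relation.Nullary using (Dec; yes; no)
  open import Relation.Nullary.Decidable using (_⊎-dec_; _×-dec_)
  open import Relation.Binary using (Decidable)

  FarFrom : ∀ {n} → Edges n → List (Fin n) → Fin n → Set
  FarFrom F B z = All (λ b → Far F b z) B

  module _ {n : ℕ} {F : Edges n} (F-deg : IsDegree≤2 F) where

    open IsDegree≤2 F-deg

    near? : Decidable (Near F)
    near? a b = (a ≟ b) ⊎-dec (nbr? a b ⊎-dec FinP.any? (λ c → nbr? a c ×-dec nbr? c b))
      where
      nbr? : ∀ a b → Dec (Nbr F a b)
      nbr? a b = F a b BoolP.≟ true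

    nbrs : Fin n → List (Fin n)
    nbrs a = filter (λ b → F a b BoolP.≟ true) (allFin n)

    ∈-nbrs : ∀ {a b} → Nbr F a b → b ∈ nbrs a
    ∈-nbrs e = ∈-filter⁺ _ (∈-allFin _) e

    ∈-nbrs⁻ : ∀ {a b} → b ∈ nbrs a → Nbr F a b
    ∈-nbrs⁻ {a} b∈ = proj₂ (∈-filter⁻ (λ b → F a b BoolP.≟ true) {xs = allFin n} b∈)

    length-nbrs : ∀ a → length (nbrs a) ≤ 2
    length-nbrs a = unique⇒length≤2 (UniqueP.filter⁺ _ (UniqueP.allFin⁺ n))
      λ b∈ c∈ d∈ → degree≤2 a (∈-nbrs⁻ b∈) (∈-nbrs⁻ c∈) (∈-nbrs⁻ d∈)

    ball : Fin n → List (Fin n)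
    ball a = a ∷ nbrs a ++ concatMap nbrs (nbrs a)

    ∈-ball : ∀ {a b} → Near F a b → b ∈ ball a
    ∈-ball (inj₁ refl)                 = here refl
    ∈-ball (inj₂ (inj₁ ab))            = there (∈-++⁺ˡ (∈-nbrs ab))
    ∈-ball {a} (inj₂ (inj₂ (c , ac , cb))) =
      there (∈-++⁺ʳ (nbrs a) (∈-concatMap⁺ nbrs (Any.map (λ { refl → ∈-nbrs cb }) (∈-nbrs ac))))

    length-ball : ∀ a → length (ball a) ≤ 7
    length-ball a = s≤s (begin
      length (nbrs a ++ concatMap nbrs (nbrs a))        ≡⟨ ListP.length-++ (nbrs a) ⟩
      length (nbrs a) + length (concatMap nbrs (nbrs a))
        ≤⟨ ℕP.+-mono-≤ (length-nbrs a) (length-concatMap≤ nbrs (nbrs a) length-nbrs) ⟩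
      2 + 2 * length (nbrs a)                           ≤⟨ ℕP.+-monoʳ-≤ 2 (ℕP.*-monoʳ-≤ 2 (length-nbrs a)) ⟩
      6                                                 ∎)
      where open ℕP.≤-Reasoning

    greedy : List (Fin n) → List (Fin n) → List (Fin n)
    greedy B []      = []
    greedy B (l ∷ L) with any? (λ b → near? b l) B
    ... | yes _ = greedy B L
    ... | no  _ = l ∷ greedy (l ∷ B) L

    greedy-far : ∀ B L → All (FarFrom F B) (greedy B L)
    greedy-far B []      = []
    greedy-far B (l ∷ L) with any? (λ b → near? b l) B
    ... | yes _  = greedy-far B L
    ... | no ¬nr = ¬Any⇒All¬ B ¬nr ∷ All.map (λ { (_ ∷ far) → far }) (greedy-far (l ∷ B) L)

    greedy-apart : ∀ B L → AllPairs (Far F) (greedy B L)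
    greedy-apart B []      = []
    greedy-apart B (l ∷ L) with any? (λ b → near? b l) B
    ... | yes _ = greedy-apart B L
    ... | no  _ = All.map (λ { (far ∷ _) → far }) (greedy-far (l ∷ B) L) ∷ greedy-apart (l ∷ B) L

    greedy-⊆ : ∀ B L → greedy B L ⊆ L
    greedy-⊆ B []      ()
    greedy-⊆ B (l ∷ L) z∈ with any? (λ b → near? b l) B
    greedy-⊆ B (l ∷ L) z∈         | yes _ = there (greedy-⊆ B L z∈)
    greedy-⊆ B (l ∷ L) (here z≡l) | no  _ = here z≡l
    greedy-⊆ B (l ∷ L) (there z∈) | no  _ = there (greedy-⊆ (l ∷ B) L z∈)

    greedy-covers : ∀ B L {a} → a ∈ L → Any (λ k → Near F k a) (greedy B L ++ B)
    greedy-covers B (l ∷ L) a∈ with any? (λ b → near? b l) B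
    greedy-covers B (l ∷ L) (here refl) | yes nr = AnyP.++⁺ʳ (greedy B L) nr
    greedy-covers B (l ∷ L) (there a∈)  | yes _  = greedy-covers B L a∈
    greedy-covers B (l ∷ L) (here refl) | no  _  = here (inj₁ refl)
    greedy-covers B (l ∷ L) (there a∈)  | no  _  =
      Any-resp-↭ (shift l (greedy (l ∷ B) L) B) (greedy-covers (l ∷ B) L a∈)

    -- Each element of L is within distance 2 of greedy B L or of B, and a ball of radius 2
    -- has at most 7 elements.
    length≤7*greedy : ∀ B L → Unique L → length L ≤ 7 * (length (greedy B L) + length B)
    length≤7*greedy B L uniq = begin
      length L
        ≤⟨ unique⊆⇒length≤ uniq (λ a∈ → ∈-concatMap⁺ ball (Any.map ∈-ball (greedy-covers B L a∈))) ⟩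
      length (concatMap ball (greedy B L ++ B))  ≤⟨ length-concatMap≤ ball (greedy B L ++ B) length-ball ⟩
      7 * length (greedy B L ++ B)               ≡⟨ cong (7 *_) (ListP.length-++ (greedy B L)) ⟩
      7 * (length (greedy B L) + length B)       ∎
      where open ℕP.≤-Reasoning

module RotationSequences where

  open import Defs hiding (sym; irrefl)
  open ListsAndSubsets
  open AtMost using (AtMostOne)
  open DegreeTwoGraphs
  open Reachability
  open FarApartPivots
  open import Data.Bool using (true; false)
  import Data.Bool.Properties as BoolP
  open import Data.Nat using (ℕ; suc)
  open import Data.Fin using (Fin; _≟_)
  import Data.Fin.Properties as FinP
  open import Data.Fin.Subset using (Subset) renaming (_∈_ to _∈ₛ_; _⊆_ to _⊆ₛ_)
  open import Data.List using (List; []; _∷_; _∷ʳ_)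
  open import Data.List.Membership.Propositional using (_∈_)
  open import Data.List.Relation.Binary.Subset.Propositional using (_⊆_)
  open import Data.List.Relation.Binary.Subset.Propositional.Properties using (Any-resp-⊆; All-resp-⊇)
  open import Data.List.Relation.Unary.All as All using (All; []; _∷_)
  open import Data.List.Relation.Unary.All.Properties using (∷ʳ⁺; All¬⇒¬Any)
  open import Data.List.Relation.Unary.AllPairs using (AllPairs; []; _∷_)
  import Data.List.Relation.Unary.AllPairs.Properties as AllPairsP
  open import Data.List.Relation.Unary.Any as Any using (Any; here; there)
  open import Data.Product using (∃-syntax; _×_; _,_; proj₁; proj₂)
  open import Data.Sum using (_⊎_; inj₁; inj₂)
  import Data.Sum as Sum
  open import Relation.Binary.PropositionalEquality
  open import Relation.Nullary using (yes; no; contradiction)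

  RotationChoice : ∀ {n} → Edges n → Fin n → Fin n → Fin n → Set
  RotationChoice E x y z =
    (Nbr E z y × (Reach E x z → ReachAvoid E z x y)) ⊎ ((∀ w → E z w ≡ false) × y ≡ z)

  choose-newEndpoint : ∀ {n} {E : Edges n} → IsDegree≤2 E → ∀ {x z} → x ≢ z →
                       ∃[ y ] RotationChoice E x y z
  choose-newEndpoint {E = E} deg {x} {z} x≢z with FinP.any? (λ w → E z w BoolP.≟ true)
  ... | no none = z , inj₂ ((λ w → BoolP.¬-not (λ zw → none (w , zw))) , refl)
  ... | yes (w , zw) with reach? E x z
  ...   | no ¬r = w , inj₁ (zw , λ r → contradiction r ¬r)
  ...   | yes r with first-entry r x≢z
  ...     | y , yz , avoid = y , inj₁ (IsDegree≤2.symmetric deg yz , λ _ → avoid)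

  ClosedNbr : ∀ {n} → Edges n → Fin n → Fin n → Set
  ClosedNbr F z y = y ≡ z ⊎ Nbr F z y

  closedNbr-near : ∀ {n} {F : Edges n} {z y} → ClosedNbr F z y → Near F z y
  closedNbr-near (inj₁ y≡z) = inj₁ (sym y≡z)
  closedNbr-near (inj₂ zy)  = inj₂ (inj₁ zy)

  module Rotating {n : ℕ} (G : Graph n) (vs : Subset n) {F : Edges n} (F-deg : IsDegree≤2 F)
                  (v : Fin n) (v-end : IsEndpoint vs F v) (U : Subset n) (U⊆vs : U ⊆ₛ vs) where

    -- A (U, i)-rotation of F from v to y with all pivots in B, and the invariants that let it be
    -- extended: away from B the current forest agrees with F, so a pivot far from B has the same
    -- neighbours as in F.
    record Rotation (i : ℕ) (B : List (Fin n)) (y : Fin n) : Set where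
      field
        forest            : Edges n
        pivots            : List (Fin n)
        sequence          : RotSeq G vs F v i forest y pivots
        pivots-far-from-v : All (Far F v) pivots
        pivots-far-apart  : AllPairs (Far F) pivots
        pivots-interior   : All (Int F U) pivots
        pivots⊆B          : All (_∈ B) pivots
        forest-degree≤2   : IsDegree≤2 forest
        endpoint          : IsEndpoint vs forest y
        end∈U             : y ∈ₛ U
        end-near-B        : Any (λ b → Near F b y) B
        agrees-away-from-B : ∀ {w} → FarFrom F B w → ∀ u → forest w u ≡ F w u

    start : ∀ {B} → v ∈ B → v ∈ₛ U → Rotation 0 B v
    start v∈B v∈U = record
      { forest = F ; pivots = [] ; sequence = done
      ; pivots-far-from-v = [] ; pivots-far-apart = [] ; pivots-interior = [] ; pivots⊆B = []
      ; forest-degree≤2 = F-deg ; endpoint = v-end ; end∈U = v∈U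
      ; end-near-B = Any.map (λ { refl → inj₁ refl }) v∈B
      ; agrees-away-from-B = λ _ _ → refl
      }

    weaken : ∀ {i B B′ y} → B ⊆ B′ → Rotation i B y → Rotation i B′ y
    weaken B⊆B′ r = record
      { forest = forest ; pivots = pivots ; sequence = sequence
      ; pivots-far-from-v = pivots-far-from-v ; pivots-far-apart = pivots-far-apart
      ; pivots-interior = pivots-interior ; forest-degree≤2 = forest-degree≤2
      ; endpoint = endpoint ; end∈U = end∈U
      ; pivots⊆B = All.map B⊆B′ pivots⊆B
      ; end-near-B = Any-resp-⊆ B⊆B′ end-near-B
      ; agrees-away-from-B = λ far → agrees-away-from-B (All-resp-⊇ B⊆B′ far)
      }
      where open Rotation r

    adj⇒≢ : ∀ {x z} → adj G x z ≡ true → x ≢ z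
    adj⇒≢ {x} xz refl = contradiction (trans (sym (Graph.irrefl G x)) xz) λ ()

    rotSeq-snoc : ∀ {E x i E′ w ps y z} → RotSeq G vs E x i E′ w ps → OneRot G vs E′ w y z →
                  RotSeq G vs E x (suc i) (rotate E′ w y z) y (ps ∷ʳ z)
    rotSeq-snoc done         rot = step rot done
    rotSeq-snoc (step r seq) rot = step r (rotSeq-snoc seq rot)

    agrees-after-rotation : ∀ {i B x y z} (r : Rotation i B x) → ClosedNbr F z y →
                            ∀ {w} → FarFrom F (z ∷ B) w → ∀ u → rotate (Rotation.forest r) x y z w u ≡ F w u
    agrees-after-rotation {x = x} {y} {z} r zy {w} (z-far-w ∷ B-far-w) u =
      trans (Rotate.rotate-away forest x y z w≢x w≢y w≢z u) (agrees-away-from-B B-far-w u)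
      where
      open Rotation r
      w≢z : w ≢ z
      w≢z refl = z-far-w (inj₁ refl)
      w≢y : w ≢ y
      w≢y refl = z-far-w (closedNbr-near zy)
      w≢x : w ≢ x
      w≢x refl = All¬⇒¬Any B-far-w end-near-B

    extend : ∀ {i B x} → Rotation i B x → v ∈ B → ∀ {z} → Int F U z → adj G x z ≡ true → FarFrom F B z →
             ∃[ y ] (Rotation (suc i) (z ∷ B) y × ClosedNbr F z y)
    extend {i} {B} {x} r v∈B {z} z-int xz z-far
      with choose-newEndpoint (Rotation.forest-degree≤2 r) (adj⇒≢ xz)
    ... | y , choice = y , rotation , closed
      where
      open Rotation r
      x≢z = adj⇒≢ xz

      closed : ClosedNbr F z y
      closed = Sum.[ (λ (zy , _) → inj₂ (trans (sym (agrees-away-from-B z-far y)) zy))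
                   , (λ (_ , y≡z) → inj₁ y≡z) ]′ choice

      y∈U : y ∈ₛ U
      y∈U = Sum.[ (λ y≡z → subst (_∈ₛ U) (sym y≡z) (proj₁ z-int)) , proj₂ z-int y ]′ closed

      x-end : AtMostOne (Nbr forest x)
      x-end = proj₂ endpoint _ _

      new-end : NewEndpoint forest z y
      new-end = Sum.map proj₁ (λ c → c) choice

      step-rot : OneRot G vs forest x y z
      step-rot = record
        { old-endpoint = endpoint ; pivot-in = U⊆vs (proj₁ z-int) ; pivot-adj = xz ; choice = choice }

      rotation : Rotation (suc i) (z ∷ B) y
      rotation = record
        { forest = rotate forest x y z
        ; pivots = pivots ∷ʳ z
        ; sequence = rotSeq-snoc sequence step-rot
        ; pivots-far-from-v = ∷ʳ⁺ pivots-far-from-v (All.lookup z-far v∈B)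
        ; pivots-far-apart =
            AllPairsP.++⁺ pivots-far-apart ([] ∷ []) (All.map (λ p∈B → All.lookup z-far p∈B ∷ []) pivots⊆B)
        ; pivots-interior = ∷ʳ⁺ pivots-interior z-int
        ; pivots⊆B = ∷ʳ⁺ (All.map there pivots⊆B) (here refl)
        ; forest-degree≤2 = rotate-isDegree≤2 forest-degree≤2 x≢z x-end new-end
        ; endpoint = U⊆vs y∈U , λ _ _ → rotate-newEndpoint forest-degree≤2 x≢z x-end new-end
        ; end∈U = y∈U
        ; end-near-B = here (closedNbr-near closed)
        ; agrees-away-from-B = agrees-after-rotation r closed
        }

module EndpointGrowth where

  open import Defs hiding (sym; irrefl)
  open ListsAndSubsets
  open DegreeTwoGraphs
  open FarApartPivots
  open RotationSequences
  open GrowthArithmetic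
  open RationalApproximation using (Expansion)
  open import Data.Nat using (ℕ; zero; suc; _+_; _*_; _^_; _≤_; _<_; _≤?_; z≤n; s≤s)
  import Data.Nat.Properties as ℕP
  open import Data.Nat.DivMod using (_/_; m/n*n≤m; n/n≡1; /-monoˡ-≤)
  open import Data.Bool using (true)
  open import Data.Fin using (Fin)
  open import Data.Fin.Subset using (Subset; ∣_∣) renaming (_∈_ to _∈ₛ_; _⊆_ to _⊆ₛ_)
  open import Data.Fin.Subset.Properties using (∣p∣≤n)
  open import Data.List using (List; []; _∷_; _++_; length; take)
  import Data.List.Properties as ListP
  open import Data.List.Membership.Propositional using (_∈_)
  open import Data.List.Membership.Propositional.Properties using (∈-++⁺ʳ)
  open import Data.List.Relation.Binary.Subset.Propositional using (_⊆_)
  open import Data.List.Relation.Binary.Subset.Propositional.Properties using (xs⊆x∷xs)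
  open import Data.List.Relation.Unary.All as All using (All; []; _∷_)
  import Data.List.Relation.Unary.All.Properties as AllP
  open import Data.List.Relation.Unary.AllPairs using (AllPairs; []; _∷_)
  import Data.List.Relation.Unary.AllPairs.Properties as AllPairsP
  open import Data.List.Relation.Unary.Any as Any using (Any; here; there)
  open import Data.List.Relation.Unary.Unique.Propositional using (Unique)
  open import Data.Product using (∃-syntax; _×_; _,_)
  open import Data.Sum using (inj₁; inj₂)
  open import Relation.Binary.PropositionalEquality
  open import Relation.Nullary using (Dec; yes; no; contradiction)

  module _ {n : ℕ} (G : Graph n) (vs : Subset n) {F : Edges n} (F-deg : IsDegree≤2 F)
           (v : Fin n) (v-end : IsEndpoint vs F v) (U : Subset n) (U⊆vs : U ⊆ₛ vs) where

    open IsDegree≤2 F-deg using (symmetric)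
    open Rotating G vs F-deg v v-end U U⊆vs

    Pivot : List (Fin n) → List (Fin n) → Fin n → Set
    Pivot T B z = Int F U z × (∃[ x ] (x ∈ T × adj G x z ≡ true)) × FarFrom F B z

    closedNbrs-near : ∀ {z z′ y} → ClosedNbr F z y → ClosedNbr F z′ y → Near F z z′
    closedNbrs-near (inj₁ refl) (inj₁ refl) = inj₁ refl
    closedNbrs-near (inj₁ refl) (inj₂ z′y)  = inj₂ (inj₁ (symmetric z′y))
    closedNbrs-near (inj₂ zy)   (inj₁ refl) = inj₂ (inj₁ zy)
    closedNbrs-near (inj₂ zy)   (inj₂ z′y)  = inj₂ (inj₂ (_ , zy , symmetric z′y))

    record Advanced (i : ℕ) (B Zs : List (Fin n)) : Set where
      field
        ends             : List (Fin n)
        ends-unique      : Unique ends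
        rotations        : All (Rotation (suc i) (Zs ++ B)) ends
        length-ends      : length ends ≡ length Zs
        ends-near-pivots : All (λ y → Any (λ z → ClosedNbr F z y) Zs) ends

    -- The new endpoints are distinct: each lies within distance 1 of its own pivot, and the pivots
    -- are pairwise at distance at least 3.
    rotate-at-pivots : ∀ {i B T} → v ∈ B → All (Rotation i B) T →
                       ∀ Zs → All (Pivot T B) Zs → AllPairs (Far F) Zs → Advanced i B Zs
    rotate-at-pivots v∈B rots [] [] [] = record
      { ends = [] ; ends-unique = [] ; rotations = [] ; length-ends = refl ; ends-near-pivots = [] }
    rotate-at-pivots {B = B} v∈B rots (z ∷ Zs)
                     ((z-int , (x , x∈T , xz) , z-far) ∷ pivs) (z-apart ∷ apart)
      with extend (All.lookup rots x∈T) v∈B z-int xz z-far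
    ... | y , rot , zy = record
      { ends = y ∷ ends
      ; ends-unique = All.map distinct ends-near-pivots ∷ ends-unique
      ; rotations = weaken z∷B⊆ rot ∷ All.map (weaken (xs⊆x∷xs _ z)) rotations
      ; length-ends = cong suc length-ends
      ; ends-near-pivots = here zy ∷ All.map there ends-near-pivots
      }
      where
      open Advanced (rotate-at-pivots v∈B rots Zs pivs apart)
      z∷B⊆ : z ∷ B ⊆ z ∷ Zs ++ B
      z∷B⊆ (here refl) = here refl
      z∷B⊆ (there b∈B) = there (∈-++⁺ʳ Zs b∈B)
      distinct : ∀ {y′} → Any (λ z′ → ClosedNbr F z′ y′) Zs → y ≢ y′
      distinct near refl = AllP.All¬⇒¬Any z-apart (Any.map (closedNbrs-near zy) near)

    module Growth (v∈U : v ∈ₛ U) (c : ℕ) (100≤c : 100 ≤ c)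
                  (expands : Expansion G U (Int F U) (5000 * suc c) c) (U-large : 100000 * c ≤ ∣ U ∣) where

      -- Expansion applies to sets of at most m endpoints.
      N K m : ℕ
      N = ∣ U ∣
      K = 5000 * suc c
      m = N / K

      Km≤N : K * m ≤ N
      Km≤N = subst (_≤ N) (ℕP.*-comm m K) (m/n*n≤m N K)

      1≤m : 1 ≤ m
      1≤m = subst (_≤ m) (n/n≡1 K) (/-monoˡ-≤ K (100000c≤N⇒5000[1+c]≤N 100≤c U-large))

      record Pivots (T B : List (Fin n)) : Set where
        field
          Z        : List (Fin n)
          Z-pivots : All (Pivot T B) Z
          Z-apart  : AllPairs (Far F) Z
          count    : c * length T ≤ 7 * (length Z + length B)

      find-pivots : ∀ {i B} T → Unique T → All (Rotation i B) T → K * length T ≤ N → Pivots T B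
      find-pivots {B = B} T T-unique rots KT≤N with expands (fromList T) X⊆U KX≤N
        where
        X⊆U : fromList T ⊆ₛ U
        X⊆U x∈ = Rotation.end∈U (All.lookup rots (∈-fromList⁻ x∈))
        KX≤N = subst (λ t → K * t ≤ N) (sym (∣fromList∣≡length T-unique)) KT≤N
      ... | S , S-nbrs , cX≤S = record
        { Z = Z ; Z-pivots = All.tabulate pivot ; Z-apart = greedy-apart F-deg B L ; count = count }
        where
        L = toList S
        Z = greedy F-deg B L
        pivot : ∀ {z} → z ∈ Z → Pivot T B z
        pivot z∈ with S-nbrs _ (∈-toList⁻ (greedy-⊆ F-deg B L z∈))
        ... | _ , (x , x∈ , xz) , z-int =
          z-int , (x , ∈-fromList⁻ x∈ , xz) , All.lookup (greedy-far F-deg B L) z∈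
        count : c * length T ≤ 7 * (length Z + length B)
        count = begin
          c * length T               ≡⟨ cong (c *_) (∣fromList∣≡length T-unique) ⟨
          c * ∣ fromList T ∣         ≤⟨ cX≤S ⟩
          ∣ S ∣                      ≡⟨ length-toList S ⟨
          length L                   ≤⟨ length≤7*greedy F-deg B L (toList-unique S) ⟩
          7 * (length Z + length B)  ∎
          where open ℕP.≤-Reasoning

      record Level (i : ℕ) : Set where
        field
          ends forbidden  : List (Fin n)
          ends-unique     : Unique ends
          rotations       : All (Rotation i forbidden) ends
          v∈forbidden     : v ∈ forbidden
          1≤ends          : 1 ≤ length ends
          ends≤m          : length ends ≤ m
          forbidden≤2ends : length forbidden ≤ 2 * length ends
          power≤ends²     : suc c ^ i ≤ length ends * length ends

        pivots : Pivots ends forbidden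
        pivots = find-pivots ends ends-unique rotations (ℕP.≤-trans (ℕP.*-monoʳ-≤ K ends≤m) Km≤N)

      record Outcome : Set where
        field
          steps          : ℕ
          ends forbidden : List (Fin n)
          ends-unique    : Unique ends
          rotations      : All (Rotation steps forbidden) ends
          large          : N ≤ 100000 * length ends
          few-steps      : suc c ^ steps ≤ n * n

      level₀ : Level 0
      level₀ = record
        { ends = v ∷ [] ; forbidden = v ∷ [] ; ends-unique = [] ∷ []
        ; rotations = start (here refl) v∈U ∷ [] ; v∈forbidden = here refl
        ; 1≤ends = ℕP.≤-refl ; ends≤m = 1≤m ; forbidden≤2ends = s≤s z≤n ; power≤ends² = ℕP.≤-refl
        }

      module Step {i : ℕ} (L : Level i) where

        open Level L
        open Pivots pivots

        private
          t = length ends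
          z = length Z

          3ct≤28z : 3 * (c * t) ≤ 28 * z
          3ct≤28z = ct≤7[z+b]⇒3ct≤28z 100≤c {t} {length forbidden} {z}
                      (ℕP.≤-trans forbidden≤2ends (ℕP.*-monoˡ-≤ t (ℕP.n≤1+n 2))) count

          10t≤z : 10 * t ≤ z
          10t≤z = 3ct≤28z⇒10t≤z 100≤c 3ct≤28z

        t<z : t < z
        t<z = begin-strict
          t          <⟨ ℕP.+-monoˡ-≤ t 1≤ends ⟩
          t + t      ≤⟨ ℕP.+-monoʳ-≤ t (ℕP.m≤n*m t 9) ⟩
          10 * t     ≤⟨ 10t≤z ⟩
          z          ∎
          where open ℕP.≤-Reasoning

        module A = Advanced (rotate-at-pivots v∈forbidden rotations Z Z-pivots Z-apart)

        next-level : z ≤ m → Level (suc i)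
        next-level z≤m = record
          { ends = A.ends ; forbidden = Z ++ forbidden ; ends-unique = A.ends-unique ; rotations = A.rotations
          ; v∈forbidden = ∈-++⁺ʳ Z v∈forbidden
          ; 1≤ends = as-z {1 ≤_} (ℕP.≤-trans (s≤s z≤n) t<z)
          ; ends≤m = as-z {_≤ m} z≤m
          ; forbidden≤2ends = as-z {λ t′ → length (Z ++ forbidden) ≤ 2 * t′} (begin
              length (Z ++ forbidden)   ≡⟨ ListP.length-++ Z ⟩
              z + length forbidden      ≤⟨ ℕP.+-monoʳ-≤ z forbidden≤z ⟩
              z + z                     ≡⟨ cong (z +_) (ℕP.+-identityʳ z) ⟨
              2 * z                     ∎)
          ; power≤ends² = as-z {λ t′ → suc c ^ suc i ≤ t′ * t′}
              (ℕP.≤-trans (ℕP.*-monoʳ-≤ (suc c) power≤ends²) (3ct≤28z⇒[1+c]t²≤z² 100≤c {t} {z} 3ct≤28z))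
          }
          where
          open ℕP.≤-Reasoning
          as-z : ∀ {P : ℕ → Set} → P z → P (length A.ends)
          as-z {P} = subst P (sym A.length-ends)
          forbidden≤z : length forbidden ≤ z
          forbidden≤z = ℕP.≤-trans forbidden≤2ends (ℕP.≤-trans (ℕP.*-monoˡ-≤ t (ℕP.m≤m+n 2 8)) 10t≤z)

        next-level-longer : ∀ {f} → m < t + suc f → m < length A.ends + f
        next-level-longer {f} m< = begin-strict
          m                   <⟨ m< ⟩
          t + suc f           ≡⟨ ℕP.+-suc t f ⟩
          suc t + f           ≤⟨ ℕP.+-monoˡ-≤ f t<z ⟩
          z + f               ≡⟨ cong (_+ f) A.length-ends ⟨
          length A.ends + f   ∎
          where open ℕP.≤-Reasoning

        -- Too many pivots to expand from all of them: rotate at m of them and expand once more.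
        module Finish (m≤z : m ≤ z) where

          Zs B₁ : List (Fin n)
          Zs = take m Z
          B₁ = Zs ++ forbidden

          module A₁ = Advanced (rotate-at-pivots v∈forbidden rotations Zs
                                  (AllP.take⁺ m Z-pivots) (AllPairsP.take⁺ m Z-apart))

          T₁≡m : length A₁.ends ≡ m
          T₁≡m = trans A₁.length-ends (trans (ListP.length-take m Z) (ℕP.m≤n⇒m⊓n≡m m≤z))

          B₁≤3m : length B₁ ≤ 3 * m
          B₁≤3m = begin
            length (Zs ++ forbidden)      ≡⟨ ListP.length-++ Zs ⟩
            length Zs + length forbidden  ≡⟨ cong (_+ length forbidden) Zs≡m ⟩
            m + length forbidden          ≤⟨ ℕP.+-monoʳ-≤ m (ℕP.≤-trans forbidden≤2ends (ℕP.*-monoʳ-≤ 2 ends≤m)) ⟩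
            m + 2 * m                     ∎
            where
            open ℕP.≤-Reasoning
            Zs≡m = trans (sym A₁.length-ends) T₁≡m

          P₂ : Pivots A₁.ends B₁
          P₂ = find-pivots A₁.ends A₁.ends-unique A₁.rotations (subst (λ t′ → K * t′ ≤ N) (sym T₁≡m) Km≤N)

          module A₂ = Advanced (rotate-at-pivots (∈-++⁺ʳ Zs v∈forbidden) A₁.rotations
                                  (Pivots.Z P₂) (Pivots.Z-pivots P₂) (Pivots.Z-apart P₂))

          z₂ = length (Pivots.Z P₂)

          3cm≤28z₂ : 3 * (c * m) ≤ 28 * z₂
          3cm≤28z₂ = ct≤7[z+b]⇒3ct≤28z 100≤c {m} {length B₁} {z₂} B₁≤3m
                       (subst (λ t′ → c * t′ ≤ 7 * (z₂ + length B₁)) T₁≡m (Pivots.count P₂))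

          outcome : Outcome
          outcome = record
            { steps = 2 + i ; ends = A₂.ends ; forbidden = Pivots.Z P₂ ++ B₁
            ; ends-unique = A₂.ends-unique ; rotations = A₂.rotations
            ; large = subst (λ t′ → N ≤ 100000 * t′) (sym A₂.length-ends)
                        (3cm≤28z⇒N≤100000z 100≤c {m} {z₂} {N} 1≤m 3cm≤28z₂ N<K[1+m])
            ; few-steps = [1+c]^[2+i]≤n² c i power≤ends² ends≤m Km≤N (∣p∣≤n U)
            }
            where
            N<K[1+m] : N < 5000 * suc c * suc m
            N<K[1+m] = subst (N <_) (ℕP.*-comm (suc m) K) (m<[1+m/n]*n N K)

      iterate : ∀ fuel {i} (L : Level i) → m < length (Level.ends L) + fuel → Outcome
      iterate zero    L m< = contradiction (subst (m <_) (ℕP.+-identityʳ (length ends)) m<) (ℕP.≤⇒≯ ends≤m)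
        where open Level L
      iterate (suc f) L m< = continue (m ≤? length (Pivots.Z (Level.pivots L)))
        where
        continue : Dec (m ≤ length (Pivots.Z (Level.pivots L))) → Outcome
        continue (yes m≤z) = Step.Finish.outcome L m≤z
        continue (no m≰z)  =
          iterate f (Step.next-level L (ℕP.<⇒≤ (ℕP.≰⇒> m≰z))) (Step.next-level-longer L m<)

open import Defs
open import Data.Nat using (ℕ; _*_; _≤_)
open import Data.Rational as ℚ using (ℚ)
open import Data.Fin using (Fin)
open import Data.Fin.Subset using (Subset; _∈_; _⊆_; ∣_∣)
open import Data.Product using (∃-syntax; _×_)

open import Data.Nat using (suc)
import Data.Nat.Properties as ℕP
import Data.Rational.Properties as ℚP
import Data.List.Relation.Unary.All as All
open import Data.Product using (_,_; proj₁)
open import Relation.Binary.PropositionalEquality using (subst)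
import Relation.Binary.PropositionalEquality as Eq

open RationalApproximation
open ListsAndSubsets
open LinearForests
open RotationSequences
open EndpointGrowth

lemma3p4 : (C : ℚ) → ℕ→ℚ 100 ℚ.< C →
  (n : ℕ) (G : Graph n) (vs : Subset n) (F : Edges n) →
  IsLinearForest G vs F →
  (v : Fin n) → IsEndpoint vs F v →
  (U : Subset n) → IsExpander G vs F C U → v ∈ U →
  ∃[ S ] ((∀ w → w ∈ S → InE G vs F U (λ i → C ^ℚ i ℚ.≤ ℕ→ℚ (n * n)) v w)
          × ∣ U ∣ ≤ 100000 * ∣ S ∣)
lemma3p4 C 100<C n G vs F lf v v-end U (U⊆vs , expands) v∈U = from-floor (floor-above-100 C 100<C)
  where
  from-floor : ∃[ c ] (100 ≤ c × ℕ→ℚ c ℚ.≤ C × C ℚ.≤ ℕ→ℚ (suc c)) →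
               ∃[ S ] ((∀ w → w ∈ S → InE G vs F U (λ i → C ^ℚ i ℚ.≤ ℕ→ℚ (n * n)) v w)
                       × ∣ U ∣ ≤ 100000 * ∣ S ∣)
  from-floor (c , 100≤c , c≤C , C≤1+c) =
    fromList ends , new-endpoint , subst (λ s → ∣ U ∣ ≤ 100000 * s) (Eq.sym ∣S∣≡ends) large
    where
    U-large : 100000 * c ≤ ∣ U ∣
    U-large = ℕ→ℚ-cancel-≤ (ℚP.≤-trans (ℕ→ℚ-*-≤ˡ 100000 c c≤C) (proj₁ expands))

    open Growth G vs (linearForest-isDegree≤2 lf) v v-end U U⊆vs v∈U c 100≤c
                (expansion-ℕ G U (Int F U) c c≤C C≤1+c expands) U-large
    open Outcome (iterate m level₀ (ℕP.n<1+n m))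

    ∣S∣≡ends = ∣fromList∣≡length ends-unique

    new-endpoint : ∀ w → w ∈ fromList ends → InE G vs F U (λ i → C ^ℚ i ℚ.≤ ℕ→ℚ (n * n)) v w
    new-endpoint w w∈ =
      steps , forest , pivots , C^steps≤n² , sequence , pivots-far-from-v , pivots-far-apart , pivots-interior
      where
      open Rotating.Rotation (All.lookup rotations (∈-fromList⁻ w∈))
      C^steps≤n² : C ^ℚ steps ℚ.≤ ℕ→ℚ (n * n)
      C^steps≤n² = ℚP.≤-trans (^ℚ-≤-ℕ→ℚ (suc c) {{ℕ→ℚ-≤⇒nonNeg c c≤C}} C≤1+c steps)
                              (ℕ→ℚ-mono-≤ few-steps)
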